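{- Let $k,x,a,b$ be positive integers such that $x\ge 2$, $k=a+b$, and $x<k<150$. Then \[\binom{2k}{k}\neq\binom{2a}{a}\binom{x+2b}{b}.\] -}

module Defs where

{-# OPTIONS --safe #-}
module Submission where

-- For fixed b and x the equation reads  central (a + b) = central a * v  with
-- v = (x + 2b) C b, so it suffices to compare, for every b, the pairs
-- (central a , central (a + b)) with the column of values v.  Generating the
-- pairs by  (n + 1) * central (n + 1) = 2 (2n + 1) * central n  and computing
-- each column only once makes this search over a + b < 150, x < 150 small
-- enough to be decided by evaluation.

open import Defs
open import Data.Nat using (ℕ; _+_; _*_; _≤_; _<_)
open import Data.Nat.Combinatorics using (_C_)
open import Relation.Binary.PropositionalEquality using (_≡_; _≢_)

open import Data.Bool.Base using (Bool; true; T)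
open import Data.Bool.Properties using (T-≡)
open import Data.Bool.ListAction using (all)
open import Data.List.Base using (List; []; _∷_; applyUpTo)
open import Data.List.Membership.Propositional using (_∈_)
open import Data.List.Membership.Propositional.Properties using (∈-applyUpTo⁺)
open import Data.List.Relation.Unary.All using (lookup)
open import Data.List.Relation.Unary.All.Properties using (all⁺)
open import Data.List.Relation.Unary.Any using (here; there)
open import Data.Nat.Base using (zero; suc; _∸_; _!; s≤s; z≤n; NonZero)
open import Data.Nat.Combinatorics using (nCk≡n!/k![n-k]!; k![n∸k]!∣n!)
open import Data.Nat.DivMod using (_/_; m/n*n≡m; m*n/n≡m)
open import Data.Nat.Properties
  using (_≟_; *-comm; *-suc; +-suc; +-identityʳ; *-cancelʳ-≡; m*n≢0; _!*_!≢0;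
         m+n∸m≡n; m≤m+n; m≤n+m; m+n≤o⇒m≤o∸n; ≤-trans; ≤-<-trans; <⇒≤; <-trans)
open import Data.Nat.Tactic.RingSolver using (solve-∀)
open import Data.Product.Base using (_×_; _,_)
open import Function.Bundles using (Equivalence)
open import Relation.Binary.PropositionalEquality
  using (refl; sym; trans; cong; subst; subst₂; module ≡-Reasoning)
open import Relation.Nullary.Decidable using (isNo; toWitnessFalse)

nCk*k!*[n∸k]!≡n! : ∀ {n k} → k ≤ n → (n C k) * (k ! * (n ∸ k) !) ≡ n !
nCk*k!*[n∸k]!≡n! {n} {k} k≤n = begin
  (n C k) * (k ! * (n ∸ k) !)                  ≡⟨ cong (_* (k ! * (n ∸ k) !)) (nCk≡n!/k![n-k]! k≤n) ⟩
  n ! / (k ! * (n ∸ k) !) * (k ! * (n ∸ k) !)  ≡⟨ m/n*n≡m (k![n∸k]!∣n! k≤n) ⟩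
  n !                                          ∎
  where
  open ≡-Reasoning
  instance
    k!*[n∸k]!≢0 : NonZero (k ! * (n ∸ k) !)
    k!*[n∸k]!≢0 = k !* (n ∸ k) !≢0

central : ℕ → ℕ
central n = (2 * n) C n

central*n!*n!≡[2n]! : ∀ n → central n * (n ! * n !) ≡ (2 * n) !
central*n!*n!≡[2n]! n =
  subst (λ m → central n * (n ! * m !) ≡ (2 * n) !) 2n∸n≡n
        (nCk*k!*[n∸k]!≡n! (m≤m+n n (n + 0)))
  where
  2n∸n≡n : 2 * n ∸ n ≡ n
  2n∸n≡n = trans (m+n∸m≡n n (n + 0)) (+-identityʳ n)

-- Multiplied by (n + 1) * n! * n!, both sides become (2n + 2)!.
central-rec : ∀ n → suc n * central (suc n) ≡ 2 * (2 * n + 1) * central n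
central-rec n = *-cancelʳ-≡ _ _ (suc n * (f * f)) {{m*n≢0 (suc n) (f * f)}} (begin
  suc n * c′ * (suc n * (f * f))               ≡⟨ regroupˡ n c′ f ⟩
  c′ * (suc n ! * suc n !)                     ≡⟨ central*n!*n!≡[2n]! (suc n) ⟩
  (2 * suc n) !                                ≡⟨ cong _! (*-suc 2 n) ⟩
  (2 + 2 * n) * ((1 + 2 * n) * (2 * n) !)      ≡⟨ cong (λ m → (2 + 2 * n) * ((1 + 2 * n) * m))
                                                       (central*n!*n!≡[2n]! n) ⟨
  (2 + 2 * n) * ((1 + 2 * n) * (c * (f * f)))  ≡⟨ regroupʳ n c f ⟩
  2 * (2 * n + 1) * c * (suc n * (f * f))      ∎)
  where
  open ≡-Reasoning
  instance
    n!*n!≢0 : NonZero (n ! * n !)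
    n!*n!≢0 = n !* n !≢0
  f c c′ : ℕ
  f  = n !
  c  = central n
  c′ = central (suc n)
  regroupˡ : ∀ n c′ f → suc n * c′ * (suc n * (f * f)) ≡ c′ * ((suc n * f) * (suc n * f))
  regroupˡ = solve-∀
  regroupʳ : ∀ n c f → (2 + 2 * n) * ((1 + 2 * n) * (c * (f * f)))
                     ≡ 2 * (2 * n + 1) * c * (suc n * (f * f))
  regroupʳ = solve-∀

nextCentral : ℕ → ℕ → ℕ
nextCentral n c = 2 * (2 * n + 1) * c / suc n

nextCentral-central : ∀ n → nextCentral n (central n) ≡ central (suc n)
nextCentral-central n = begin
  2 * (2 * n + 1) * central n / suc n  ≡⟨ cong (_/ suc n) (central-rec n) ⟨
  suc n * central (suc n) / suc n      ≡⟨ cong (_/ suc n) (*-comm (suc n) (central (suc n))) ⟩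
  central (suc n) * suc n / suc n      ≡⟨ m*n/n≡m (central (suc n)) (suc n) ⟩
  central (suc n)                      ∎
  where open ≡-Reasoning

centralPairsFrom : (b n i cᵢ cᵢ₊ᵦ : ℕ) → List (ℕ × ℕ)
centralPairsFrom b zero    i cᵢ cᵢ₊ᵦ = []
centralPairsFrom b (suc n) i cᵢ cᵢ₊ᵦ =
  (cᵢ , cᵢ₊ᵦ) ∷ centralPairsFrom b n (suc i) (nextCentral i cᵢ) (nextCentral (i + b) cᵢ₊ᵦ)

∈-centralPairsFrom : ∀ b n i {d} → d < n →
  (central (d + i) , central (d + i + b)) ∈ centralPairsFrom b n i (central i) (central (i + b))
∈-centralPairsFrom b (suc n) i {zero}  _         = here refl
∈-centralPairsFrom b (suc n) i {suc d} (s≤s d<n) =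
  there (subst₂ (λ cᵢ cᵢ₊ᵦ → pair ∈ rest cᵢ cᵢ₊ᵦ)
                (sym (nextCentral-central i)) (sym (nextCentral-central (i + b))) pair∈rest)
  where
  rest : ℕ → ℕ → List (ℕ × ℕ)
  rest = centralPairsFrom b n (suc i)
  pair : ℕ × ℕ
  pair = (central (suc d + i) , central (suc d + i + b))
  pair∈rest : pair ∈ rest (central (suc i)) (central (suc i + b))
  pair∈rest = subst (λ m → (central m , central (m + b)) ∈ rest (central (suc i)) (central (suc i + b)))
                    (+-suc d i) (∈-centralPairsFrom b n (suc i) d<n)

centralPairs : ℕ → ℕ → List (ℕ × ℕ)
centralPairs b n = centralPairsFrom b n 0 (central 0) (central b)

∈-centralPairs : ∀ b n {a} → a < n → (central a , central (a + b)) ∈ centralPairs b n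
∈-centralPairs b n {a} a<n =
  subst (λ i → (central i , central (i + b)) ∈ centralPairs b n) (+-identityʳ a)
        (∈-centralPairsFrom b n 0 a<n)

all-sound : ∀ {A : Set} (p : A → Bool) {xs x} → T (all p xs) → x ∈ xs → T (p x)
all-sound p {xs} ok x∈xs = lookup (all⁺ p xs ok) x∈xs

noProductᵇ : List (ℕ × ℕ) → List ℕ → Bool
noProductᵇ ps vs = all (λ (c , c′) → all (λ v → isNo (c′ ≟ c * v)) vs) ps

noProductᵇ-sound : ∀ {ps vs c c′ v} → T (noProductᵇ ps vs) →
                   (c , c′) ∈ ps → v ∈ vs → c′ ≢ c * v
noProductᵇ-sound {c = c} {c′} ok c,c′∈ps v∈vs =
  toWitnessFalse (all-sound (λ v → isNo (c′ ≟ c * v)) (all-sound _ ok c,c′∈ps) v∈vs)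

binomialColumn : ℕ → ℕ → List ℕ
binomialColumn N b = applyUpTo (λ x → (2 + x + 2 * b) C b) N

-- The ranges b ∈ [1, N] and x ∈ [2, N + 2) overshoot what is needed; this costs
-- little (centralPairs b 0 is empty) and avoids arithmetic on bounds.
noCentralFactorisationᵇ : ℕ → Bool
noCentralFactorisationᵇ N =
  all (λ b → noProductᵇ (centralPairs b (N ∸ b)) (binomialColumn N b)) (applyUpTo suc N)

noCentralFactorisationᵇ-sound : ∀ N → noCentralFactorisationᵇ N ≡ true →
  ∀ {a b x} → 1 ≤ b → 2 ≤ x → a + b < N → x < N →
  central (a + b) ≢ central a * ((x + 2 * b) C b)
noCentralFactorisationᵇ-sound N ok {a} {suc b} {suc (suc x)} (s≤s z≤n) (s≤s (s≤s z≤n)) a+b<N x+2<N =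
  noProductᵇ-sound (all-sound _ (Equivalence.from T-≡ ok) (∈-applyUpTo⁺ suc b<N))
    (∈-centralPairs (suc b) (N ∸ suc b) (m+n≤o⇒m≤o∸n (suc a) a+b<N))
    (∈-applyUpTo⁺ (λ x → (2 + x + 2 * suc b) C suc b) x<N)
  where
  b<N : b < N
  b<N = <⇒≤ (≤-<-trans (m≤n+m (suc b) a) a+b<N)
  x<N : x < N
  x<N = ≤-trans (m≤n+m (suc x) 2) x+2<N

noCentralFactorisationᵇ-150 : noCentralFactorisationᵇ 150 ≡ true
noCentralFactorisationᵇ-150 = refl

proposition2p16 : (k x a b : ℕ) → 1 ≤ k → 1 ≤ x → 1 ≤ a → 1 ≤ b → 2 ≤ x → k ≡ a + b → x < k → k < 150 → (2 * k) C k ≢ ((2 * a) C a) * ((x + 2 * b) C b)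
proposition2p16 k x a b _ _ _ 1≤b 2≤x refl x<k k<150 =
  noCentralFactorisationᵇ-sound 150 noCentralFactorisationᵇ-150 1≤b 2≤x k<150 (<-trans x<k k<150)
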